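{- Let $k\ge 4$ be an even integer and let $n\ge k$ be a multiple of $k/2$. Let $\pi$ be a permutation of $N=\{0,\dots,n-1\}$, let $\Psi_0^\pi$ be the formula defined below, and let $\sigma^+$ be the all-$\mathsf{TRUE}$ assignment. If $\sigma\ne\sigma^+$ satisfies $\Psi_0^\pi$, then there exists a subset $M\subseteq\{0,1,\dots,2n/k-1\}$ of size at least $n/k$ such that for all $\ell\in M$, $\sigma$ assigns at least one variable in $C^\pi_{\ell k/2}$ to $\mathsf{FALSE}$.
   Context: Consider Boolean variables $x_0,\dots,x_{n-1}$. For $i\in\mathbb{N}$ let $\Xi^\pi_i=\{\pi(i+j \pmod n): j\in\{0,\dots,k/2-1\}\}$ and $C^\pi_i=\{x_\ell:\ell\in\Xi^\pi_i\}$. For $\ell\in\Xi^\pi_i$, $W^\pi_{i,\ell}$ is the clause of length $k/2$ on variable set $C^\pi_i$ in which $x_\ell$ appears positively and all other variables appear negated; $\Pi^\pi_i$ is the clause of length $k/2$ on variable set $C^\pi_i$ with all variables negated. Then $\Psi_0^\pi:=\bigwedge_{i\in N,\ \ell\in\Xi^\pi_i}(W^\pi_{i,\ell}\vee\Pi^\pi_{i+k/2})$. -}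

module Defs where

open import Data.Nat using (ℕ; _+_; _*_; NonZero)
open import Data.Nat.DivMod using (_mod_; _/_)
open import Data.Fin using (Fin; toℕ; _≟_)
open import Data.Fin.Permutation using (Permutation′; _⟨$⟩ʳ_)
open import Data.List using (List; map; upTo; _++_)
open import Data.List.Relation.Unary.Any using (Any)
open import Data.List.Membership.Propositional using (_∈_)
open import Data.Bool using (Bool; true; false)
open import Data.Product using (_×_; _,_)
open import Relation.Nullary.Decidable using (⌊_⌋)
open import Relation.Binary.PropositionalEquality using (_≡_)

Assignment : ℕ → Set
Assignment n = Fin n → Bool

-- A literal: (variable index, polarity); polarity true = positive, false = negated.
Literal : ℕ → Set
Literal n = Fin n × Bool

Clause : ℕ → Set
Clause n = List (Literal n)

litSat : ∀ {n} → Assignment n → Literal n → Set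
litSat σ (x , b) = σ x ≡ b

clauseSat : ∀ {n} → Assignment n → Clause n → Set
clauseSat σ c = Any (litSat σ) c

module _ (n k : ℕ) .{{_ : NonZero n}} (π : Permutation′ n) where

  Ξ : ℕ → List (Fin n)
  Ξ i = map (λ j → π ⟨$⟩ʳ ((i + j) mod n)) (upTo (k / 2))

  -- C^π_i as the list of variable indices (x_ℓ identified with ℓ)
  C : ℕ → List (Fin n)
  C = Ξ

  W : ℕ → Fin n → Clause n
  W i ℓ = map (λ x → x , ⌊ x ≟ ℓ ⌋) (Ξ i)

  Πc : ℕ → Clause n
  Πc i = map (λ x → x , false) (Ξ i)

  -- σ satisfies Ψ^π_0 = ⋀_{i ∈ N, ℓ ∈ Ξ^π_i} (W^π_{i,ℓ} ∨ Π^π_{i+k/2})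
  SatΨ0 : Assignment n → Set
  SatΨ0 σ = (i : Fin n) → (ℓ : Fin n) → ℓ ∈ Ξ (toℕ i) →
            clauseSat σ (W (toℕ i) ℓ ++ Πc (toℕ i + k / 2))

-- Read the variables cyclically in π-order, position p carrying x_{π(p mod n)}.
-- If position p is FALSE, the clause W_{p,π(p)} ∨ Π_{p+k/2} of Ψ₀ can only be satisfied
-- by another FALSE position among the next k - 1 ones. Since σ ≠ σ⁺ some position is
-- FALSE, and by n-periodicity every window of k consecutive positions contains a FALSE one.
-- The 2n/k blocks C_{jk/2} cut the cycle into segments of length k/2, so no two cyclically
-- adjacent blocks are all TRUE, and at least half of the blocks contain a FALSE variable.
module Submission where

open import Defs
open import Data.Nat using (ℕ; _+_; _*_; _≤_; NonZero)
open import Data.Nat.Divisibility using (_∣_)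
open import Data.Nat.DivMod using (_/_)
open import Data.Fin using (Fin; toℕ)
open import Data.Fin.Subset using (Subset; _∈_; ∣_∣)
open import Data.Fin.Permutation using (Permutation′)
open import Data.List.Membership.Propositional renaming (_∈_ to _∈ₗ_)
open import Data.Bool using (true; false)
open import Data.Product using (Σ; _×_; ∃; _,_)
open import Relation.Nullary using (¬_)
open import Relation.Binary.PropositionalEquality using (_≡_)

open import Data.Bool using (Bool; _∨_)
open import Data.Bool.Properties using (∨-zeroʳ; ¬-not) renaming (_≟_ to _≟ᵇ_)
open import Data.Fin.Permutation using (_⟨$⟩ʳ_; _⟨$⟩ˡ_; inverseʳ)
open import Data.Fin.Properties using (toℕ-fromℕ<; toℕ-injective; toℕ<n; ¬∀⟶∃¬) renaming (_≟_ to _≟ᶠ_)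
open import Data.List using (List; map; upTo; _++_)
open import Data.List.Membership.Propositional using (find; lose)
open import Data.List.Membership.Propositional.Properties using (∈-map⁺; ∈-map⁻; ∈-upTo⁺; ∈-upTo⁻)
open import Data.List.Properties using (map-cong)
open import Data.List.Relation.Unary.Any using (Any; any?)
open import Data.List.Relation.Unary.Any.Properties using (map⁻; ++⁻)
open import Data.Nat using (zero; suc; _<_; _∸_; _%_; z≤n; s≤s)
open import Data.Nat.DivMod using (_mod_; %-distribˡ-+; m%n%n≡m%n; [m+n]%n≡m%n; m<n⇒m%n≡m; m*n/n≡m; m/n*n≡m; /-monoˡ-≤)
open import Data.Nat.Divisibility using (divides)
open import Data.Nat.Properties
open import Algebra.Properties.CommutativeSemigroup +-commutativeSemigroup using (interchange)
open import Data.Sum using (_⊎_; inj₁; inj₂; [_,_]′)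
open import Data.Vec using (tabulate; _∷_)
open import Data.Vec.Properties using ([]=⇒lookup; lookup∘tabulate)
open import Function using (_∘_; case_of_)
open import Relation.Nullary using (Dec; yes; no; does; contradiction)
open import Relation.Nullary.Decidable using (⌊_⌋; dec-true)
open import Relation.Binary.PropositionalEquality using (refl; sym; trans; cong; subst; module ≡-Reasoning)

indicator : Bool → ℕ
indicator true = 1
indicator false = 0

count : (ℕ → Bool) → ℕ → ℕ
count g zero = 0
count g (suc m) = count g m + indicator (g m)

count-cons : ∀ g m → count g (suc m) ≡ indicator (g 0) + count (g ∘ suc) m
count-cons g zero = +-comm 0 _
count-cons g (suc m) = begin
  count g (suc m) + indicator (g (suc m))                     ≡⟨ cong (_+ indicator (g (suc m))) (count-cons g m) ⟩
  indicator (g 0) + count (g ∘ suc) m + indicator (g (suc m)) ≡⟨ +-assoc (indicator (g 0)) _ _ ⟩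
  indicator (g 0) + count (g ∘ suc) (suc m)                   ∎
  where open ≡-Reasoning

count-rotate : ∀ g m → g m ≡ g 0 → count (g ∘ suc) m ≡ count g m
count-rotate g m gm≡g0 = +-cancelˡ-≡ (indicator (g 0)) _ _ (begin
  indicator (g 0) + count (g ∘ suc) m ≡⟨ count-cons g m ⟨
  count g m + indicator (g m)         ≡⟨ cong (λ b → count g m + indicator b) gm≡g0 ⟩
  count g m + indicator (g 0)         ≡⟨ +-comm (count g m) _ ⟩
  indicator (g 0) + count g m         ∎)
  where open ≡-Reasoning

indicator-∨ : ∀ a b → a ∨ b ≡ true → 1 ≤ indicator a + indicator b
indicator-∨ true b _ = s≤s z≤n
indicator-∨ false true _ = s≤s z≤n

count-pair-≥ : ∀ g h m → (∀ i → i < m → g i ∨ h i ≡ true) → m ≤ count g m + count h m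
count-pair-≥ g h zero _ = z≤n
count-pair-≥ g h (suc m) cover = begin
  suc m                             ≡⟨ +-comm 1 m ⟩
  m + 1                             ≤⟨ +-mono-≤ (count-pair-≥ g h m λ i i<m → cover i (m<n⇒m<1+n i<m))
                                                (indicator-∨ (g m) (h m) (cover m (n<1+n m))) ⟩
  count g m + count h m + (indicator (g m) + indicator (h m)) ≡⟨ interchange (count g m) _ _ _ ⟩
  count g (suc m) + count h (suc m) ∎
  where open ≤-Reasoning

count-cyclic-cover : ∀ g m → g m ≡ g 0 → (∀ i → i < m → g i ∨ g (suc i) ≡ true) →
                     m ≤ count g m + count g m
count-cyclic-cover g m gm≡g0 cover =
  subst (λ c → m ≤ count g m + c) (count-rotate g m gm≡g0) (count-pair-≥ g (g ∘ suc) m cover)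

∣x∷p∣ : ∀ {m} x (p : Subset m) → ∣ x ∷ p ∣ ≡ indicator x + ∣ p ∣
∣x∷p∣ true p = refl
∣x∷p∣ false p = refl

∣tabulate∣≡count : ∀ g m → ∣ tabulate {n = m} (g ∘ toℕ) ∣ ≡ count g m
∣tabulate∣≡count g zero = refl
∣tabulate∣≡count g (suc m) = begin
  ∣ tabulate {n = suc m} (g ∘ toℕ) ∣                     ≡⟨ ∣x∷p∣ (g 0) (tabulate {n = m} (g ∘ suc ∘ toℕ)) ⟩
  indicator (g 0) + ∣ tabulate {n = m} (g ∘ suc ∘ toℕ) ∣ ≡⟨ cong (indicator (g 0) +_) (∣tabulate∣≡count (g ∘ suc) m) ⟩
  indicator (g 0) + count (g ∘ suc) m                    ≡⟨ count-cons g m ⟨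
  count g (suc m)                                        ∎
  where open ≡-Reasoning

NextFalseWithin : ℕ → (ℕ → Bool) → ℕ → Set
NextFalseWithin w f q = ∃ λ j → 0 < j × j < w × f (q + j) ≡ false

FalseGapsBelow : ℕ → (ℕ → Bool) → Set
FalseGapsBelow w f = ∀ q → f q ≡ false → NextFalseWithin w f q

FalseInWindow : ℕ → (ℕ → Bool) → ℕ → Set
FalseInWindow w f q = ∃ λ t → t < w × f (t + q) ≡ false

false-in-every-window : ∀ {w} (f : ℕ → Bool) → FalseGapsBelow w f →
  ∀ {p} → f p ≡ false → ∀ d → FalseInWindow w f (d + p)
false-in-every-window f gap {p} fp zero with gap p fp
... | _ , 0<j , j<w , _ = 0 , <-trans 0<j j<w , fp
false-in-every-window f gap {p} fp (suc d) with false-in-every-window f gap fp d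
... | suc t , t<w , ft = t , <⇒≤ t<w , subst (λ x → f x ≡ false) (sym (+-suc t (d + p))) ft
... | zero , _ , fdp with gap (d + p) fdp
...   | suc j , _ , j<w , fj =
  j , <⇒≤ j<w , subst (λ x → f x ≡ false) (trans (+-comm (d + p) (suc j)) (sym (+-suc j (d + p)))) fj

periodic-false-in-every-window : ∀ {w n} (f : ℕ → Bool) → (∀ x → f (x + n) ≡ f x) →
  FalseGapsBelow w f → ∀ {p} → f p ≡ false → p ≤ n → ∀ q → FalseInWindow w f q
periodic-false-in-every-window {n = n} f periodic gap {p} fp p≤n q
  with false-in-every-window f gap fp (q + n ∸ p)
... | t , t<w , ft = t , t<w , (begin
  f (t + q)               ≡⟨ periodic (t + q) ⟨
  f (t + q + n)           ≡⟨ cong f (+-assoc t q n) ⟩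
  f (t + (q + n))         ≡⟨ cong (λ x → f (t + x)) (m∸n+n≡m (≤-trans p≤n (m≤n+m n q))) ⟨
  f (t + (q + n ∸ p + p)) ≡⟨ ft ⟩
  false                   ∎)
  where open ≡-Reasoning

half+half : ∀ {k} → 2 ∣ k → k / 2 + k / 2 ≡ k
half+half {k} 2∣k = begin
  k / 2 + k / 2       ≡⟨ cong (k / 2 +_) (+-identityʳ (k / 2)) ⟨
  2 * (k / 2)         ≡⟨ *-comm 2 (k / 2) ⟩
  k / 2 * 2           ≡⟨ m/n*n≡m 2∣k ⟩
  k                   ∎
  where open ≡-Reasoning

0<half : ∀ {k} → 4 ≤ k → 0 < k / 2
0<half 4≤k = <-≤-trans (s≤s z≤n) (/-monoˡ-≤ 2 4≤k)

double-multiple/ : ∀ m {k} .{{_ : NonZero k}} → 2 ∣ k → 2 * (m * (k / 2)) / k ≡ m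
double-multiple/ m {k} 2∣k = begin
  2 * (m * h) / k             ≡⟨ cong (λ x → (m * h + x) / k) (+-identityʳ (m * h)) ⟩
  (m * h + m * h) / k         ≡⟨ cong (_/ k) (*-distribˡ-+ m h h) ⟨
  m * (h + h) / k             ≡⟨ cong (λ x → m * x / k) (half+half 2∣k) ⟩
  m * k / k                   ≡⟨ m*n/n≡m m k ⟩
  m                           ∎
  where
  h = k / 2
  open ≡-Reasoning

blocks*half≡n : ∀ {k n} .{{_ : NonZero k}} → 2 ∣ k → k / 2 ∣ n → 2 * n / k * (k / 2) ≡ n
blocks*half≡n {k} {n} 2∣k (divides m n≡m*h) = begin
  2 * n / k * (k / 2)             ≡⟨ cong (λ x → 2 * x / k * (k / 2)) n≡m*h ⟩
  2 * (m * (k / 2)) / k * (k / 2) ≡⟨ cong (_* (k / 2)) (double-multiple/ m 2∣k) ⟩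
  m * (k / 2)                     ≡⟨ n≡m*h ⟨
  n                               ∎
  where open ≡-Reasoning

bound-from-half : ∀ {k n b c} → 2 ∣ k → b * (k / 2) ≡ n → b ≤ c + c → n ≤ k * c
bound-from-half {k} {n} {b} {c} 2∣k b*h≡n b≤2c = begin
  n                   ≡⟨ b*h≡n ⟨
  b * h               ≤⟨ *-monoˡ-≤ h b≤2c ⟩
  (c + c) * h         ≡⟨ *-distribʳ-+ h c c ⟩
  c * h + c * h       ≡⟨ *-distribˡ-+ c h h ⟨
  c * (h + h)         ≡⟨ cong (c *_) (half+half 2∣k) ⟩
  c * k               ≡⟨ *-comm c k ⟩
  k * c               ∎
  where
  h = k / 2
  open ≤-Reasoning

toℕ-mod : ∀ {n} .{{_ : NonZero n}} p → toℕ (p mod n) ≡ p % n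
toℕ-mod p = toℕ-fromℕ< _

mod-toℕ : ∀ {n} .{{_ : NonZero n}} (i : Fin n) → toℕ i mod n ≡ i
mod-toℕ i = toℕ-injective (trans (toℕ-mod (toℕ i)) (m<n⇒m%n≡m (toℕ<n i)))

mod-cong : ∀ {n} .{{_ : NonZero n}} {a b} → a % n ≡ b % n → a mod n ≡ b mod n
mod-cong {a = a} {b} e = toℕ-injective (trans (toℕ-mod a) (trans e (sym (toℕ-mod b))))

toℕ-mod-% : ∀ {n} .{{_ : NonZero n}} p → toℕ (p mod n) % n ≡ p % n
toℕ-mod-% {n} p = trans (cong (_% n) (toℕ-mod p)) (m%n%n≡m%n p n)

%-cong-+ʳ : ∀ {n} .{{_ : NonZero n}} {a b} j → a % n ≡ b % n → (a + j) % n ≡ (b + j) % n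
%-cong-+ʳ {n} {a} {b} j e = begin
  (a + j) % n             ≡⟨ %-distribˡ-+ a j n ⟩
  (a % n + j % n) % n     ≡⟨ cong (λ c → (c + j % n) % n) e ⟩
  (b % n + j % n) % n     ≡⟨ %-distribˡ-+ b j n ⟨
  (b + j) % n             ∎
  where open ≡-Reasoning

does≡true⇒ : ∀ {A : Set} (a? : Dec A) → does a? ≡ true → A
does≡true⇒ (yes a) _ = a

satisfied-literal : ∀ {n} {σ : Assignment n} {xs : List (Fin n)} (pol : Fin n → Bool) →
  clauseSat σ (map (λ x → x , pol x) xs) → ∃ λ x → x ∈ₗ xs × σ x ≡ pol x
satisfied-literal pol sat = find (map⁻ sat)

module _ (n k : ℕ) .{{_ : NonZero n}} (π : Permutation′ n) (σ : Assignment n) where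

  private
    h : ℕ
    h = k / 2

  πvar : ℕ → Fin n
  πvar p = π ⟨$⟩ʳ (p mod n)

  πval : ℕ → Bool
  πval = σ ∘ πvar

  Ξ-cong : ∀ {a b} → a % n ≡ b % n → Ξ n k π a ≡ Ξ n k π b
  Ξ-cong e = map-cong (λ j → cong (π ⟨$⟩ʳ_) (mod-cong (%-cong-+ʳ j e))) (upTo h)

  πvar-periodic : ∀ p → πvar (p + n) ≡ πvar p
  πvar-periodic p = cong (π ⟨$⟩ʳ_) (mod-cong ([m+n]%n≡m%n p n))

  πvar-position : ∀ x → πvar (toℕ (π ⟨$⟩ˡ x)) ≡ x
  πvar-position x = trans (cong (π ⟨$⟩ʳ_) (mod-toℕ (π ⟨$⟩ˡ x))) (inverseʳ π)

  πvar∈Ξ : ∀ {p j} → j < h → πvar (p + j) ∈ₗ Ξ n k π p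
  πvar∈Ξ j<h = ∈-map⁺ _ (∈-upTo⁺ j<h)

  ∈Ξ⇒πvar : ∀ {p x} → x ∈ₗ Ξ n k π p → ∃ λ j → j < h × x ≡ πvar (p + j)
  ∈Ξ⇒πvar x∈ with j , j∈ , refl ← ∈-map⁻ _ x∈ = j , ∈-upTo⁻ j∈ , refl

  next-false : SatΨ0 n k π σ → 0 < h → ∀ {p} → πval p ≡ false → NextFalseWithin (h + h) πval p
  next-false sat 0<h {p} πp≡false = [ from-W , from-Π ]′ (++⁻ (W n k π (toℕ i) (πvar p)) clause)
    where
    i = p mod n

    πvar-p∈Ξ : πvar p ∈ₗ Ξ n k π p
    πvar-p∈Ξ = subst (λ q → πvar q ∈ₗ Ξ n k π p) (+-identityʳ p) (πvar∈Ξ 0<h)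

    clause : clauseSat σ (W n k π (toℕ i) (πvar p) ++ Πc n k π (toℕ i + h))
    clause = sat i (πvar p) (subst (πvar p ∈ₗ_) (Ξ-cong (sym (toℕ-mod-% p))) πvar-p∈Ξ)

    W-literal : ∀ {x} → x ∈ₗ Ξ n k π p → σ x ≡ ⌊ x ≟ᶠ πvar p ⌋ → NextFalseWithin (h + h) πval p
    W-literal {x} x∈ σx with x ≟ᶠ πvar p | ∈Ξ⇒πvar x∈
    ... | yes refl | _ = case trans (sym σx) πp≡false of λ ()
    ... | no x≢πvar-p | zero , _ , refl = contradiction (cong πvar (+-identityʳ p)) x≢πvar-p
    ... | no _ | suc j , j<h , refl = suc j , s≤s z≤n , <-≤-trans j<h (m≤m+n h h) , σx

    from-W : clauseSat σ (W n k π (toℕ i) (πvar p)) → NextFalseWithin (h + h) πval p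
    from-W sat-W with x , x∈ , σx ← satisfied-literal (λ x → ⌊ x ≟ᶠ πvar p ⌋) sat-W =
      W-literal (subst (x ∈ₗ_) (Ξ-cong (toℕ-mod-% p)) x∈) σx

    Π-literal : ∀ {x} → x ∈ₗ Ξ n k π (p + h) → σ x ≡ false → NextFalseWithin (h + h) πval p
    Π-literal x∈ σx with j , j<h , refl ← ∈Ξ⇒πvar x∈ =
      h + j , <-≤-trans 0<h (m≤m+n h j) , +-monoʳ-< h j<h , subst (λ q → πval q ≡ false) (+-assoc p h j) σx

    from-Π : clauseSat σ (Πc n k π (toℕ i + h)) → NextFalseWithin (h + h) πval p
    from-Π sat-Π with x , x∈ , σx ← satisfied-literal (λ _ → false) sat-Π =
      Π-literal (subst (x ∈ₗ_) (Ξ-cong (%-cong-+ʳ h (toℕ-mod-% p))) x∈) σx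

  some-πval-false : ¬ (∀ x → σ x ≡ true) → ∃ λ p → p ≤ n × πval p ≡ false
  some-πval-false σ≢σ⁺ with x , σx≢true ← ¬∀⟶∃¬ n _ (λ x → σ x ≟ᵇ true) σ≢σ⁺ =
    toℕ (π ⟨$⟩ˡ x) , <⇒≤ (toℕ<n _) , trans (cong σ (πvar-position x)) (¬-not σx≢true)

  false-in-every-πwindow : SatΨ0 n k π σ → 0 < h → ¬ (∀ x → σ x ≡ true) →
                           ∀ q → FalseInWindow (h + h) πval q
  false-in-every-πwindow sat 0<h σ≢σ⁺ with p , p≤n , πp≡false ← some-πval-false σ≢σ⁺ =
    periodic-false-in-every-window πval (cong σ ∘ πvar-periodic) (λ _ → next-false sat 0<h) πp≡false p≤n

  HasFalse : ℕ → Set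
  HasFalse q = Any (λ x → σ x ≡ false) (C n k π q)

  HasFalse? : ∀ q → Dec (HasFalse q)
  HasFalse? q = any? (λ x → σ x ≟ᵇ false) (C n k π q)

  double-window-HasFalse : ∀ {q t} → t < h + h → πval (t + q) ≡ false → HasFalse q ⊎ HasFalse (h + q)
  double-window-HasFalse {q} {t} t<2h πt+q≡false with t <? h
  ... | yes t<h = inj₁ (lose (πvar∈Ξ t<h) (subst (λ r → πval r ≡ false) (+-comm t q) πt+q≡false))
  ... | no t≮h = inj₂ (lose (πvar∈Ξ t∸h<h) (subst (λ r → πval r ≡ false) t+q≡h+q+[t∸h] πt+q≡false))
    where
    h+[t∸h]≡t : h + (t ∸ h) ≡ t
    h+[t∸h]≡t = m+[n∸m]≡n (≮⇒≥ t≮h)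

    t∸h<h : t ∸ h < h
    t∸h<h = +-cancelˡ-< h _ _ (subst (_< h + h) (sym h+[t∸h]≡t) t<2h)

    t+q≡h+q+[t∸h] : t + q ≡ h + q + (t ∸ h)
    t+q≡h+q+[t∸h] = begin
      t + q             ≡⟨ cong (_+ q) h+[t∸h]≡t ⟨
      h + (t ∸ h) + q   ≡⟨ +-assoc h _ q ⟩
      h + (t ∸ h + q)   ≡⟨ cong (h +_) (+-comm (t ∸ h) q) ⟩
      h + (q + (t ∸ h)) ≡⟨ +-assoc h q _ ⟨
      h + q + (t ∸ h)   ∎
      where open ≡-Reasoning

  block-has-false : ℕ → Bool
  block-has-false j = does (HasFalse? (j * h))

  blocks-cover : SatΨ0 n k π σ → 0 < h → ¬ (∀ x → σ x ≡ true) →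
                 ∀ j → block-has-false j ∨ block-has-false (suc j) ≡ true
  blocks-cover sat 0<h σ≢σ⁺ j with t , t<2h , πt≡false ← false-in-every-πwindow sat 0<h σ≢σ⁺ (j * h) =
    [ (λ first → cong (_∨ block-has-false (suc j)) (dec-true (HasFalse? (j * h)) first))
    , (λ second → trans (cong (block-has-false j ∨_) (dec-true (HasFalse? (suc j * h)) second)) (∨-zeroʳ _))
    ]′ (double-window-HasFalse t<2h πt≡false)

  block-has-false-periodic : ∀ m → m * h ≡ n → block-has-false m ≡ block-has-false 0
  block-has-false-periodic m m*h≡n =
    cong (does ∘ any? (λ x → σ x ≟ᵇ false)) (Ξ-cong (trans (cong (_% n) m*h≡n) ([m+n]%n≡m%n 0 n)))

  block-has-false-witness : ∀ j → block-has-false j ≡ true →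
                            ∃ λ x → x ∈ₗ C n k π (j * h) × σ x ≡ false
  block-has-false-witness j e = find (does≡true⇒ (HasFalse? (j * h)) e)

corollary3p3 : (k n : ℕ) → 4 ≤ k → 2 ∣ k → k ≤ n → (k / 2) ∣ n → .{{_ : NonZero n}} → .{{_ : NonZero k}} →
    (π : Permutation′ n) → (σ : Assignment n) →
    ¬ (∀ x → σ x ≡ true) → SatΨ0 n k π σ →
    Σ (Subset ((2 * n) / k)) λ M → (n ≤ k * ∣ M ∣) ×
      (∀ (ℓ : Fin ((2 * n) / k)) → ℓ ∈ M →
        ∃ λ x → x ∈ₗ C n k π (toℕ ℓ * (k / 2)) × σ x ≡ false)
corollary3p3 k n 4≤k 2∣k _ h∣n π σ σ≢σ⁺ sat = M , n≤k*∣M∣ , M⇒false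
  where
  blocks = (2 * n) / k
  hit = block-has-false n k π σ

  M : Subset blocks
  M = tabulate (hit ∘ toℕ)

  blocks≤2∣M∣ : blocks ≤ ∣ M ∣ + ∣ M ∣
  blocks≤2∣M∣ = subst (λ c → blocks ≤ c + c) (sym (∣tabulate∣≡count hit blocks))
    (count-cyclic-cover hit blocks (block-has-false-periodic n k π σ blocks (blocks*half≡n 2∣k h∣n))
                                   (λ j _ → blocks-cover n k π σ sat (0<half 4≤k) σ≢σ⁺ j))

  n≤k*∣M∣ : n ≤ k * ∣ M ∣
  n≤k*∣M∣ = bound-from-half 2∣k (blocks*half≡n 2∣k h∣n) blocks≤2∣M∣

  M⇒false : ∀ ℓ → ℓ ∈ M → ∃ λ x → x ∈ₗ C n k π (toℕ ℓ * (k / 2)) × σ x ≡ false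
  M⇒false ℓ ℓ∈M = block-has-false-witness n k π σ (toℕ ℓ)
                     (trans (sym (lookup∘tabulate (hit ∘ toℕ) ℓ)) ([]=⇒lookup ℓ∈M))
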